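{- If $\mathsf X$ is a $\sigma$-algebra over a termlike $\sigma$-algebra $\mathsf U$, then $\mathrm{Pow}_{\text{amgis}}(\mathsf X)$ is an amgis-algebra over $\mathsf U$.
   Context: Atoms $\mathbb A$ (countably infinite; $a,b,c$ distinct atoms), finite permutations, swappings $(a\ b)$, nominal sets, support, $a\#x$ meaning $a\notin\mathrm{supp}(x)$, equivariance as standard. Termlike $\sigma$-algebra $\mathsf U$: nominal set with equivariant $x[a:=u]$ and equivariant injection $\mathrm{atm}:\mathbb A\to\mathsf U$ satisfying $a[a:=x]=x$; $x[a:=a]=x$; $a\#x\Rightarrow x[a:=u]=x$; $b\#x\Rightarrow x[a:=u]=((b\ a)\cdot x)[b:=u]$; $a\#v\Rightarrow x[a:=u][b:=v]=x[b:=v][a:=u[b:=v]]$. A $\sigma$-algebra over $\mathsf U$ is a nominal set $\mathsf X$ with equivariant $\mathsf X\times\mathbb A\times\mathsf U\to\mathsf X$ satisfying the last four axioms ($x\in\mathsf X$, $u,v\in\mathsf U$). An amgis-algebra over $\mathsf U$: a set with permutation action $\mathsf P$ and an equivariant map $p[u\Leftarrow a]:\mathsf P\times\mathsf U\times\mathbb A\to\mathsf P$ such that $a\#v$ implies $p[v\Leftarrow b][u\Leftarrow a]=p[u[b:=v]\Leftarrow a][v\Leftarrow b]$. $\mathrm{Pow}_{\text{amgis}}(\mathsf X)$: the set of all subsets $p\subseteq|\mathsf X|$ (not necessarily finitely supported), with $\pi\cdot p=\{\pi\cdot x\mid x\in p\}$ and $p[u\Leftarrow a]=\{x\in|\mathsf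 X|\mid x[a:=u]\in p\}$. -}

module Defs where

open import Level using (Level; _⊔_; suc; 0ℓ)
open import Data.Nat using (ℕ; _≟_)
open import Data.Product using (Σ; ∃; _×_; _,_)
open import Data.List using (List; []; _∷_; _++_)
open import Data.List.Membership.Propositional using (_∈_; _∉_)
open import Relation.Binary.PropositionalEquality using (_≡_; _≢_)
open import Relation.Nullary using (yes; no)
open import Relation.Unary using (Pred)
open import Function using (id)

Atom : Set
Atom = ℕ

swapAtom : Atom → Atom → Atom → Atom
swapAtom a b c with c ≟ a
... | yes _ = b
... | no _ with c ≟ b
...   | yes _ = a
...   | no _ = c

-- Finite permutations are presented as finite composites of swappings
-- (every finite permutation is such a composite).  The list
-- (a₁,b₁) ∷ … ∷ (aₙ,bₙ) ∷ [] denotes (a₁ b₁) ∘ … ∘ (aₙ bₙ).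
Perm : Set
Perm = List (Atom × Atom)

⟦_⟧ : Perm → Atom → Atom
⟦ [] ⟧ c = c
⟦ (a , b) ∷ π ⟧ c = swapAtom a b (⟦ π ⟧ c)

⦅_∙_⦆ : Atom → Atom → Perm
⦅ a ∙ b ⦆ = (a , b) ∷ []

-- Sets with a permutation action (up to an equivalence relation, so that
-- possibly non-finitely-supported subsets can be compared extensionally)

record IsPermAction {c ℓ : Level} (A : Set c) (_≈_ : A → A → Set ℓ)
                    (_·_ : Perm → A → A) : Set (c ⊔ ℓ) where
  field
    ≈-refl  : ∀ {x} → x ≈ x
    ≈-sym   : ∀ {x y} → x ≈ y → y ≈ x
    ≈-trans : ∀ {x y z} → x ≈ y → y ≈ z → x ≈ z
    ·-cong  : ∀ π {x y} → x ≈ y → (π · x) ≈ (π · y)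
    act-id   : ∀ x → ([] · x) ≈ x
    act-comp : ∀ π π' x → ((π ++ π') · x) ≈ (π · (π' · x))
    act-resp : ∀ π π' → (∀ a → ⟦ π ⟧ a ≡ ⟦ π' ⟧ a) → ∀ x → (π · x) ≈ (π' · x)

record Nominal : Set₁ where
  field
    Carrier : Set
    _·_     : Perm → Carrier → Carrier
    isPermAction : IsPermAction Carrier _≡_ _·_

  Supports : List Atom → Carrier → Set
  Supports S x = ∀ π → (∀ a → a ∈ S → ⟦ π ⟧ a ≡ a) → (π · x) ≡ x

  field
    finitelySupported : ∀ x → ∃ λ S → Supports S x

  -- a # x :  a ∉ supp(x), i.e. some finite support of x omits a
  -- (supp(x) is the intersection of all finite supports).
  _#_ : Atom → Carrier → Set
  a # x = ∃ λ S → Supports S x × a ∉ S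


record TermlikeSigma : Set₁ where
  field
    nom : Nominal
  open Nominal nom
  field
    _[_≔_] : Carrier → Atom → Carrier → Carrier
    atm    : Atom → Carrier
    sub-equivariant : ∀ π x a u → (π · (x [ a ≔ u ])) ≡ ((π · x) [ ⟦ π ⟧ a ≔ (π · u) ])
    atm-equivariant : ∀ π a → (π · atm a) ≡ atm (⟦ π ⟧ a)
    atm-injective   : ∀ a b → atm a ≡ atm b → a ≡ b
    σ-var  : ∀ a x → (atm a [ a ≔ x ]) ≡ x
    σ-id   : ∀ x a → (x [ a ≔ atm a ]) ≡ x
    σ-#    : ∀ a x u → a # x → (x [ a ≔ u ]) ≡ x
    σ-α    : ∀ a b x u → a ≢ b → b # x → (x [ a ≔ u ]) ≡ ((⦅ b ∙ a ⦆ · x) [ b ≔ u ])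
    σ-σ    : ∀ a b x u v → a ≢ b → a # v →
             ((x [ a ≔ u ]) [ b ≔ v ]) ≡ ((x [ b ≔ v ]) [ a ≔ (u [ b ≔ v ]) ])

record SigmaAlg (U : TermlikeSigma) : Set₁ where
  module U = TermlikeSigma U
  module UN = Nominal U.nom
  field
    nom : Nominal
  open Nominal nom
  field
    _[_≔_] : Carrier → Atom → UN.Carrier → Carrier
    sub-equivariant : ∀ π x a u → (π · (x [ a ≔ u ])) ≡ ((π · x) [ ⟦ π ⟧ a ≔ (π UN.· u) ])
    σ-id   : ∀ x a → (x [ a ≔ U.atm a ]) ≡ x
    σ-#    : ∀ a x u → a # x → (x [ a ≔ u ]) ≡ x
    σ-α    : ∀ a b x u → a ≢ b → b # x → (x [ a ≔ u ]) ≡ ((⦅ b ∙ a ⦆ · x) [ b ≔ u ])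
    σ-σ    : ∀ a b x u v → a ≢ b → a UN.# v →
             ((x [ a ≔ u ]) [ b ≔ v ]) ≡ ((x [ b ≔ v ]) [ a ≔ (u U.[ b ≔ v ]) ])

record IsAmgisAlgebra {c ℓ : Level} (U : TermlikeSigma)
                      (A : Set c) (_≈_ : A → A → Set ℓ) (_·_ : Perm → A → A)
                      (_[_⇐_] : A → Nominal.Carrier (TermlikeSigma.nom U) → Atom → A)
                      : Set (c ⊔ ℓ) where
  module U = TermlikeSigma U
  module UN = Nominal U.nom
  field
    isPermAction : IsPermAction A _≈_ _·_
    ⇐-cong       : ∀ {p q} u a → p ≈ q → (p [ u ⇐ a ]) ≈ (q [ u ⇐ a ])
    ⇐-equivariant : ∀ π p u a → (π · (p [ u ⇐ a ])) ≈ ((π · p) [ π UN.· u ⇐ ⟦ π ⟧ a ])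
    amgis-axiom  : ∀ a b p u v → a ≢ b → a UN.# v →
                   ((p [ v ⇐ b ]) [ u ⇐ a ]) ≈ ((p [ (u U.[ b ≔ v ]) ⇐ a ]) [ v ⇐ b ])

-- Pow_amgis(X): all subsets of |X| (not necessarily finitely supported),
-- compared extensionally.

module PowAmgis {U : TermlikeSigma} (X : SigmaAlg U) where
  private
    module XN = Nominal (SigmaAlg.nom X)
    module UN = Nominal (TermlikeSigma.nom U)
    module XS = SigmaAlg X

  Pow : Set₁
  Pow = Pred XN.Carrier 0ℓ

  _≐_ : Pow → Pow → Set
  p ≐ q = (∀ x → p x → q x) × (∀ x → q x → p x)

  _·ᴾ_ : Perm → Pow → Pow
  (π ·ᴾ p) y = ∃ λ x → p x × (π XN.· x) ≡ y

  _[_⇐_] : Pow → UN.Carrier → Atom → Pow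
  (p [ u ⇐ a ]) x = p (x XS.[ a ≔ u ])

-- Both structures come from the σ-action alone: p[u⇐a] is the preimage of p under
-- x ↦ x[a:=u], and π·p the image of p under x ↦ π·x.  Preimages turn the composite
-- x[a:=u][b:=v] into the iterated pullback, so the amgis axiom is literally the σ
-- axiom x[a:=u][b:=v] = x[b:=v][a:=u[b:=v]] read under p; equivariance of the pullback
-- is the commutation of images with preimages along the equivariant σ-action, which
-- only needs every permutation action to be invertible (by the reversed list of swaps).
-- No finite support of p is ever used.
module Submission where

open import Defs
open import Level using (0ℓ)
open import Data.Nat using (_≟_)
open import Data.Product using (∃; _×_; _,_)
open import Data.List using ([]; _∷_; _++_; reverse)
open import Data.List.Properties using (reverse-involutive; unfold-reverse)
open import Relation.Binary.PropositionalEquality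
open import Relation.Nullary using (Dec; yes; no)
open import Relation.Unary using (Pred; _⊢_)
open import Data.Empty using (⊥-elim)

swapAtom-left : ∀ a b → swapAtom a b a ≡ b
swapAtom-left a b with a ≟ a
... | yes _ = refl
... | no a≢a = ⊥-elim (a≢a refl)

swapAtom-right : ∀ a b → swapAtom a b b ≡ a
swapAtom-right a b with b ≟ a
... | yes b≡a = b≡a
... | no _ with b ≟ b
...   | yes _ = refl
...   | no b≢b = ⊥-elim (b≢b refl)

swapAtom-fresh : ∀ a b c → c ≢ a → c ≢ b → swapAtom a b c ≡ c
swapAtom-fresh a b c c≢a c≢b with c ≟ a
... | yes c≡a = ⊥-elim (c≢a c≡a)
... | no _ with c ≟ b
...   | yes c≡b = ⊥-elim (c≢b c≡b)
...   | no _ = refl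

swapAtom-involutive : ∀ a b c → swapAtom a b (swapAtom a b c) ≡ c
swapAtom-involutive a b c = by-cases (c ≟ a) (c ≟ b)
  where
  by-cases : Dec (c ≡ a) → Dec (c ≡ b) → swapAtom a b (swapAtom a b c) ≡ c
  by-cases (yes c≡a) _ = begin
    swapAtom a b (swapAtom a b c) ≡⟨ cong (λ d → swapAtom a b (swapAtom a b d)) c≡a ⟩
    swapAtom a b (swapAtom a b a) ≡⟨ cong (swapAtom a b) (swapAtom-left a b) ⟩
    swapAtom a b b                ≡⟨ swapAtom-right a b ⟩
    a                             ≡⟨ sym c≡a ⟩
    c                             ∎
    where open ≡-Reasoning
  by-cases (no _) (yes c≡b) = begin
    swapAtom a b (swapAtom a b c) ≡⟨ cong (λ d → swapAtom a b (swapAtom a b d)) c≡b ⟩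
    swapAtom a b (swapAtom a b b) ≡⟨ cong (swapAtom a b) (swapAtom-right a b) ⟩
    swapAtom a b a                ≡⟨ swapAtom-left a b ⟩
    b                             ≡⟨ sym c≡b ⟩
    c                             ∎
    where open ≡-Reasoning
  by-cases (no c≢a) (no c≢b) =
    trans (cong (swapAtom a b) (swapAtom-fresh a b c c≢a c≢b)) (swapAtom-fresh a b c c≢a c≢b)

⟦⟧-++ : ∀ π ρ a → ⟦ π ++ ρ ⟧ a ≡ ⟦ π ⟧ (⟦ ρ ⟧ a)
⟦⟧-++ [] ρ a = refl
⟦⟧-++ ((b , c) ∷ π) ρ a = cong (swapAtom b c) (⟦⟧-++ π ρ a)

⟦reverse⟧-inverseˡ : ∀ π a → ⟦ reverse π ⟧ (⟦ π ⟧ a) ≡ a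
⟦reverse⟧-inverseˡ [] a = refl
⟦reverse⟧-inverseˡ ((b , c) ∷ π) a = begin
    ⟦ reverse ((b , c) ∷ π) ⟧ (swapAtom b c (⟦ π ⟧ a))
  ≡⟨ cong (λ ρ → ⟦ ρ ⟧ (swapAtom b c (⟦ π ⟧ a))) (unfold-reverse (b , c) π) ⟩
    ⟦ reverse π ++ ⦅ b ∙ c ⦆ ⟧ (swapAtom b c (⟦ π ⟧ a))
  ≡⟨ ⟦⟧-++ (reverse π) ⦅ b ∙ c ⦆ _ ⟩
    ⟦ reverse π ⟧ (swapAtom b c (swapAtom b c (⟦ π ⟧ a)))
  ≡⟨ cong ⟦ reverse π ⟧ (swapAtom-involutive b c _) ⟩
    ⟦ reverse π ⟧ (⟦ π ⟧ a)
  ≡⟨ ⟦reverse⟧-inverseˡ π a ⟩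
    a ∎
  where open ≡-Reasoning

⟦reverse⟧-inverseʳ : ∀ π a → ⟦ π ⟧ (⟦ reverse π ⟧ a) ≡ a
⟦reverse⟧-inverseʳ π a =
  subst (λ ρ → ⟦ ρ ⟧ (⟦ reverse π ⟧ a) ≡ a) (reverse-involutive π)
        (⟦reverse⟧-inverseˡ (reverse π) a)

module NominalProperties (N : Nominal) where
  open Nominal N
  open IsPermAction isPermAction

  ·-trivial : ∀ π → (∀ a → ⟦ π ⟧ a ≡ a) → ∀ x → π · x ≡ x
  ·-trivial π π≗id x = trans (act-resp π [] π≗id x) (act-id x)

  ·-reverse-inverseˡ : ∀ π x → reverse π · (π · x) ≡ x
  ·-reverse-inverseˡ π x = trans (sym (act-comp (reverse π) π x))
    (·-trivial (reverse π ++ π)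
       (λ a → trans (⟦⟧-++ (reverse π) π a) (⟦reverse⟧-inverseˡ π a)) x)

  ·-reverse-inverseʳ : ∀ π x → π · (reverse π · x) ≡ x
  ·-reverse-inverseʳ π x = trans (sym (act-comp π (reverse π) x))
    (·-trivial (π ++ reverse π)
       (λ a → trans (⟦⟧-++ π (reverse π) a) (⟦reverse⟧-inverseʳ π a)) x)

  ·-injective : ∀ π {x y} → π · x ≡ π · y → x ≡ y
  ·-injective π {x} {y} πx≡πy = trans (sym (·-reverse-inverseˡ π x))
    (trans (cong (reverse π ·_) πx≡πy) (·-reverse-inverseˡ π y))

-- Subsets of a nominal set under the image action; as in PowAmgis, they need not be
-- finitely supported, so this is only a set with a permutation action.
module PowersetAction (N : Nominal) where
  open Nominal N
  open IsPermAction isPermAction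
  open NominalProperties N

  _≐_ : Pred Carrier 0ℓ → Pred Carrier 0ℓ → Set
  p ≐ q = (∀ x → p x → q x) × (∀ x → q x → p x)

  _·ᴾ_ : Perm → Pred Carrier 0ℓ → Pred Carrier 0ℓ
  (π ·ᴾ p) y = ∃ λ x → p x × π · x ≡ y

  ·ᴾ-isPermAction : IsPermAction (Pred Carrier 0ℓ) _≐_ _·ᴾ_
  ·ᴾ-isPermAction = record
    { ≈-refl   = (λ _ px → px) , (λ _ px → px)
    ; ≈-sym    = λ (p⊆q , q⊆p) → q⊆p , p⊆q
    ; ≈-trans  = λ (p⊆q , q⊆p) (q⊆r , r⊆q) →
                   (λ x px → q⊆r x (p⊆q x px)) , (λ x rx → q⊆p x (r⊆q x rx))
    ; ·-cong   = λ π (p⊆q , q⊆p) →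
                   (λ { _ (x , px , e) → x , p⊆q x px , e })
                 , (λ { _ (x , qx , e) → x , q⊆p x qx , e })
    ; act-id   = λ p → (λ { _ (x , px , e) → subst p (trans (sym (act-id x)) e) px })
                     , (λ y py → y , py , act-id y)
    ; act-comp = λ π π' p →
                   (λ { _ (x , px , e) → π' · x , (x , px , refl) , trans (sym (act-comp π π' x)) e })
                 , (λ { _ (_ , (x , px , refl) , e) → x , px , trans (act-comp π π' x) e })
    ; act-resp = λ π π' π≗π' p →
                   (λ { _ (x , px , e) → x , px , trans (sym (act-resp π π' π≗π' x)) e })
                 , (λ { _ (x , px , e) → x , px , trans (act-resp π π' π≗π' x) e })
    }

  ⊢-resp-≐ : ∀ (f : Carrier → Carrier) {p q} → p ≐ q → (f ⊢ p) ≐ (f ⊢ q)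
  ⊢-resp-≐ f (p⊆q , q⊆p) = (λ x → p⊆q (f x)) , (λ x → q⊆p (f x))

  ⊢-cong : ∀ {f g : Carrier → Carrier} → (∀ x → f x ≡ g x) → ∀ p → (f ⊢ p) ≐ (g ⊢ p)
  ⊢-cong f≗g p = (λ x → subst p (f≗g x)) , (λ x → subst p (sym (f≗g x)))

  -- The inclusion ⊇ pulls y back to reverse π · y, whence invertibility of the action.
  ·ᴾ-⊢ : ∀ π {f g : Carrier → Carrier} → (∀ x → π · f x ≡ g (π · x)) →
         ∀ p → (π ·ᴾ (f ⊢ p)) ≐ (g ⊢ (π ·ᴾ p))
  ·ᴾ-⊢ π {f} {g} f~g p =
      (λ { _ (x , pfx , refl) → f x , pfx , f~g x })
    , (λ y (z , pz , πz≡gy) → reverse π · y , subst p (f-reverse y z πz≡gy) pz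
                             , ·-reverse-inverseʳ π y)
    where
    f-reverse : ∀ y z → π · z ≡ g y → z ≡ f (reverse π · y)
    f-reverse y z πz≡gy = ·-injective π (begin
        π · z                  ≡⟨ πz≡gy ⟩
        g y                    ≡⟨ cong g (sym (·-reverse-inverseʳ π y)) ⟩
        g (π · (reverse π · y)) ≡⟨ sym (f~g (reverse π · y)) ⟩
        π · f (reverse π · y)  ∎)
      where open ≡-Reasoning

proposition3p17 : (U : TermlikeSigma) (X : SigmaAlg U) → IsAmgisAlgebra U (PowAmgis.Pow X) (PowAmgis._≐_ X) (PowAmgis._·ᴾ_ X) (PowAmgis._[_⇐_] X)
proposition3p17 U X = record
  { isPermAction  = ·ᴾ-isPermAction
  ; ⇐-cong        = λ u a → ⊢-resp-≐ (_[ a ≔ u ])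
  ; ⇐-equivariant = λ π p u a → ·ᴾ-⊢ π (λ x → sub-equivariant π x a u) p
  ; amgis-axiom   = λ a b p u v a≢b a#v → ⊢-cong (λ x → σ-σ a b x u v a≢b a#v) p
  }
  where
  open SigmaAlg X
  open PowersetAction nom
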